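{- For all $n\ge 0$ and $0\le j,k\le n$ we have $\binom{n}{j}\,b(n,k,j)=B(n,k,j)$. In particular $B(n,k,j)$ is divisible by $\binom{n}{j}$.
   Context: $\mathcal{B}_n$ is the set of signed permutations of order $n$: bijections $\sigma$ of $\{ -n,\ldots,n\}$ with $\sigma(-i)=-\sigma(i)$, identified with the sequence $(0,\sigma_1,\ldots,\sigma_n)$, $\sigma_i=\sigma(i)$. $\mathrm{des}(\sigma)$ is the number of $i\in\{1,\ldots,n\}$ with $\sigma_{i-1}>\sigma_i$ (where $\sigma_0=0$), and $\mathrm{neg}(\sigma)$ is the number of $i\in\{1,\ldots,n\}$ with $\sigma_i<0$. $B(n,k,j)$ is the number of $\sigma\in\mathcal{B}_n$ with $\mathrm{des}(\sigma)=k$ and $\mathrm{neg}(\sigma)=j$. For $0\le j,k\le n$, $b(n,k,j)$ is the number of $\sigma\in\mathcal{B}_n$ with $\mathrm{des}(\sigma)=k$ such that for every $1\le i\le n$: $\sigma_i<0$ if and only if $|\sigma_i|\in\{1,\ldots,j\}$. -}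

module Defs where

open import Data.Nat using (ℕ; zero; suc; _+_; _≤_; _≤?_) renaming (_≟_ to _≟ℕ_)
open import Data.Integer using (ℤ; +_; -_; ∣_∣; _<_; _<?_) renaming (_≟_ to _≟ℤ_)
open import Data.List using (List; []; _∷_; map; concatMap; upTo; length; filter; _++_)
open import Data.List.Relation.Unary.All using (All; all?)
open import Data.List.Relation.Unary.Unique.Propositional using (Unique)
open import Data.List.Relation.Unary.Unique.DecPropositional _≟ℤ_ using () renaming (unique? to uniqueℤ?)
open import Data.List.Relation.Unary.Unique.DecPropositional _≟ℕ_ using () renaming (unique? to uniqueℕ?)
open import Data.Product using (_×_)
open import Data.Bool using (if_then_else_)
open import Relation.Binary.PropositionalEquality using (_≡_)
open import Relation.Nullary using (does)
open import Relation.Nullary.Decidable using (_×-dec_; _→-dec_)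

tuples : {A : Set} → ℕ → List A → List (List A)
tuples zero    xs = [] ∷ []
tuples (suc m) xs = concatMap (λ x → map (x ∷_) (tuples m xs)) xs

range : ℕ → List ℤ
range n = map +_ (upTo (suc n)) ++ map (λ i → - (+ suc i)) (upTo n)

-- A signed permutation σ ∈ B_n, identified with the list (σ_1, ..., σ_n):
-- σ extends (by σ(0)=0, σ(-i) = -σ(i)) to a bijection of {-n..n} iff
-- the values |σ_1|, ..., |σ_n| are exactly 1..n, i.e. lie in {1..n} and are distinct.
IsSignedPerm : ℕ → List ℤ → Set
IsSignedPerm n σ = (length σ ≡ n) × (All (λ x → (1 ≤ ∣ x ∣) × (∣ x ∣ ≤ n)) σ × Unique (map ∣_∣ σ))

isSignedPerm? : (n : ℕ) → (σ : List ℤ) → Relation.Nullary.Dec (IsSignedPerm n σ)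
isSignedPerm? n σ = (length σ ≟ℕ n) ×-dec (all? (λ x → (1 ≤? ∣ x ∣) ×-dec (∣ x ∣ ≤? n)) σ ×-dec uniqueℕ? (map ∣_∣ σ))

signedPerms : ℕ → List (List ℤ)
signedPerms n = filter (isSignedPerm? n) (tuples n (range n))

descentsFrom : List ℤ → ℕ
descentsFrom (x ∷ y ∷ r) = (if does (y <? x) then 1 else 0) + descentsFrom (y ∷ r)
descentsFrom _ = 0

des : List ℤ → ℕ
des σ = descentsFrom (+ 0 ∷ σ)

neg : List ℤ → ℕ
neg σ = length (filter (λ x → x <? + 0) σ)

B : ℕ → ℕ → ℕ → ℕ
B n k j = length (filter (λ σ → (des σ ≟ℕ k) ×-dec (neg σ ≟ℕ j)) (signedPerms n))

NegExactlyBelow : ℕ → List ℤ → Set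
NegExactlyBelow j σ = All (λ x → (x < + 0 → (1 ≤ ∣ x ∣) × (∣ x ∣ ≤ j)) × ((1 ≤ ∣ x ∣) × (∣ x ∣ ≤ j) → x < + 0)) σ

negExactlyBelow? : (j : ℕ) → (σ : List ℤ) → Relation.Nullary.Dec (NegExactlyBelow j σ)
negExactlyBelow? j σ = all? (λ x → ((x <? + 0) →-dec ((1 ≤? ∣ x ∣) ×-dec (∣ x ∣ ≤? j)))
                                  ×-dec (((1 ≤? ∣ x ∣) ×-dec (∣ x ∣ ≤? j)) →-dec (x <? + 0))) σ

b : ℕ → ℕ → ℕ → ℕ
b n k j = length (filter (λ σ → (des σ ≟ℕ k) ×-dec negExactlyBelow? j σ) (signedPerms n))

-- Encode which absolute values a signed permutation σ ∈ Bₙ negates as a Boolean word of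
-- length n, its negation pattern.  Exchanging the values ±(s+1) and ±(s+2) in σ preserves
-- descents as soon as exactly one of s+1, s+2 is negated, because the only pairs whose
-- relative order it reverses have equal signs.  Hence the number of σ with k descents and a
-- given pattern is unchanged by adjacent transpositions of the pattern, so it depends only on
-- the number j of negated values, and sorting the pattern shows it equals b(n,k,j).  Summing
-- over the C(n,j) patterns with j negated values gives B(n,k,j) = C(n,j) b(n,k,j).

module Submission where

open import Defs
open import Data.Bool using (Bool; true; false; not; if_then_else_) renaming (_≟_ to _≟ᵇ_)
open import Data.Empty using (⊥-elim)
open import Data.Integer as ℤ using (ℤ; -[1+_]; ∣_∣; _<?_) renaming (_<_ to _<ℤ_; _≟_ to _≟ℤ_)
open import Data.Integer.Base using (-<+; +<+)
open import Data.List using (List; []; _∷_; [_]; _++_; map; concatMap; applyUpTo; upTo; length; filter; replicate)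
open import Data.List.Membership.Propositional using (_∈_)
open import Data.List.Membership.Propositional.Properties using (∈-map⁺; ∈-map⁻)
open import Data.List.Membership.DecPropositional _≟ℤ_ using (_∈?_)
open import Data.List.Properties
  using (∷-injectiveˡ; ∷-injectiveʳ; ++-assoc; length-map; length-applyUpTo; map-∘; map-cong; map-id; ≡-dec)
open import Data.List.Relation.Unary.All as All using (All; []; _∷_)
import Data.List.Relation.Unary.All.Properties as All
open import Data.List.Relation.Unary.AllPairs using (_∷_)
open import Data.List.Relation.Unary.Any using (here; there)
open import Data.List.Relation.Unary.Unique.Propositional using (Unique)
import Data.List.Relation.Unary.Unique.Propositional.Properties as Unique
open import Data.Nat using (ℕ; zero; suc; _+_; _*_; _∸_; _≤_; _<_; z≤n; s≤s; _<ᵇ_; _≤?_)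
  renaming (_≟_ to _≟ℕ_; _<?_ to _<ℕ?_)
open import Data.Nat.Combinatorics using (_C_; nCk+nC[k+1]≡[n+1]C[k+1])
open import Data.Nat.Divisibility using (_∣_; divides)
open import Data.Nat.Properties
  using (+-assoc; +-suc; +-identityʳ; *-comm; *-zeroʳ; *-identityʳ; *-distribˡ-+; +-commutativeSemigroup;
         ≤-reflexive; ≤-antisym; ≤-pred; <-≤-trans; 1+n≰n; m≤m+n; +-mono-≤; +-monoˡ-≤; m+n∸m≡n; suc-injective)
open import Algebra.Properties.CommutativeSemigroup +-commutativeSemigroup using (interchange; x∙yz≈y∙xz)
open import Data.Product using (_×_; _,_; proj₁; proj₂; ∃)
open import Function using (_∘_; _⇔_; mk⇔; Equivalence)
open import Relation.Nullary using (Dec; yes; no; does; ¬_; _×-dec_)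
open import Relation.Nullary.Decidable using (dec-true; dec-false; does-⇔; T?)
open import Relation.Unary using (Decidable)
open import Relation.Binary.Definitions using (DecidableEquality)
open import Relation.Binary.PropositionalEquality
  using (_≡_; _≢_; refl; sym; trans; cong; cong₂; subst; module ≡-Reasoning)


private variable
  X Y : Set

-- Finite sums and indicators

∑ : List X → (X → ℕ) → ℕ
∑ []       f = 0
∑ (x ∷ xs) f = f x + ∑ xs f

infix 5 ∑
syntax ∑ xs (λ x → e) = ∑[ x ∈ xs ] e

∑< : ℕ → (ℕ → ℕ) → ℕ
∑< zero    h = 0
∑< (suc n) h = h 0 + ∑< n (h ∘ suc)

infix 5 ∑<
syntax ∑< n (λ v → e) = ∑[ v < n ] e

∑-cong-∈ : (xs : List X) {f g : X → ℕ} → (∀ x → x ∈ xs → f x ≡ g x) → ∑ xs f ≡ ∑ xs g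
∑-cong-∈ []       e = refl
∑-cong-∈ (x ∷ xs) e = cong₂ _+_ (e x (here refl)) (∑-cong-∈ xs (λ y y∈xs → e y (there y∈xs)))

∑-cong : (xs : List X) {f g : X → ℕ} → (∀ x → f x ≡ g x) → ∑ xs f ≡ ∑ xs g
∑-cong xs e = ∑-cong-∈ xs (λ x _ → e x)

∑-++ : (xs ys : List X) (f : X → ℕ) → ∑ (xs ++ ys) f ≡ ∑ xs f + ∑ ys f
∑-++ []       ys f = refl
∑-++ (x ∷ xs) ys f = trans (cong (f x +_) (∑-++ xs ys f)) (sym (+-assoc (f x) _ _))

∑-map : (g : Y → X) (xs : List Y) (f : X → ℕ) → ∑ (map g xs) f ≡ ∑ xs (f ∘ g)
∑-map g []       f = refl
∑-map g (x ∷ xs) f = cong (f (g x) +_) (∑-map g xs f)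

∑-concatMap : (F : Y → List X) (xs : List Y) (f : X → ℕ) → ∑ (concatMap F xs) f ≡ ∑[ x ∈ xs ] ∑ (F x) f
∑-concatMap F []       f = refl
∑-concatMap F (x ∷ xs) f = trans (∑-++ (F x) (concatMap F xs) f) (cong (∑ (F x) f +_) (∑-concatMap F xs f))

∑-zero : (xs : List X) → ∑[ x ∈ xs ] 0 ≡ 0
∑-zero []       = refl
∑-zero (x ∷ xs) = ∑-zero xs

∑-one : (xs : List X) → ∑[ x ∈ xs ] 1 ≡ length xs
∑-one []       = refl
∑-one (x ∷ xs) = cong suc (∑-one xs)

∑-*ˡ : (xs : List X) (c : ℕ) (f : X → ℕ) → ∑[ x ∈ xs ] c * f x ≡ c * ∑ xs f
∑-*ˡ []       c f = sym (*-zeroʳ c)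
∑-*ˡ (x ∷ xs) c f = trans (cong (c * f x +_) (∑-*ˡ xs c f)) (sym (*-distribˡ-+ c (f x) _))

∑-*ʳ : (xs : List X) (f : X → ℕ) (c : ℕ) → ∑[ x ∈ xs ] f x * c ≡ ∑ xs f * c
∑-*ʳ xs f c = trans (∑-cong xs (λ x → *-comm (f x) c)) (trans (∑-*ˡ xs c f) (*-comm c (∑ xs f)))

∑-*0 : (xs : List X) (f : X → ℕ) → ∑[ x ∈ xs ] f x * 0 ≡ 0
∑-*0 xs f = trans (∑-cong xs (*-zeroʳ ∘ f)) (∑-zero xs)

∑-+ : (xs : List X) (f g : X → ℕ) → ∑[ x ∈ xs ] (f x + g x) ≡ ∑ xs f + ∑ xs g
∑-+ []       f g = refl
∑-+ (x ∷ xs) f g = trans (cong (f x + g x +_) (∑-+ xs f g)) (interchange (f x) (g x) (∑ xs f) (∑ xs g))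

∑-comm : (xs : List X) (ys : List Y) (F : X → Y → ℕ) → ∑[ x ∈ xs ] ∑ ys (F x) ≡ ∑[ y ∈ ys ] ∑[ x ∈ xs ] F x y
∑-comm []       ys F = sym (∑-zero ys)
∑-comm (x ∷ xs) ys F = trans (cong (∑ ys (F x) +_) (∑-comm xs ys F)) (sym (∑-+ ys (F x) _))

∑<-cong : (n : ℕ) {f g : ℕ → ℕ} → (∀ v → f v ≡ g v) → ∑< n f ≡ ∑< n g
∑<-cong zero    e = refl
∑<-cong (suc n) e = cong₂ _+_ (e 0) (∑<-cong n (e ∘ suc))

∑<-zero : (n : ℕ) → ∑[ v < n ] 0 ≡ 0
∑<-zero zero    = refl
∑<-zero (suc n) = ∑<-zero n

∑<-∑-comm : (n : ℕ) (F : ℕ → X → ℕ) (xs : List X) → ∑[ v < n ] ∑ xs (F v) ≡ ∑[ x ∈ xs ] ∑[ v < n ] F v x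
∑<-∑-comm zero    F xs = sym (∑-zero xs)
∑<-∑-comm (suc n) F xs = trans (cong (∑ xs (F 0) +_) (∑<-∑-comm n (F ∘ suc) xs)) (sym (∑-+ xs (F 0) _))

∑-applyUpTo : (n : ℕ) (g : ℕ → X) (f : X → ℕ) → ∑ (applyUpTo g n) f ≡ ∑< n (f ∘ g)
∑-applyUpTo zero    g f = refl
∑-applyUpTo (suc n) g f = cong (f (g 0) +_) (∑-applyUpTo n (g ∘ suc) f)

∑<-≤ : ∀ n (t : ℕ → ℕ) → (∀ w → t w ≤ 1) → ∑< n t ≤ n
∑<-≤ zero    t _   = z≤n
∑<-≤ (suc n) t t≤1 = +-mono-≤ (t≤1 0) (∑<-≤ n (t ∘ suc) (t≤1 ∘ suc))

∑<-≡-bound⇒≢0 : ∀ n (t : ℕ → ℕ) → (∀ w → t w ≤ 1) → ∑< n t ≡ n → ∀ v → v < n → t v ≢ 0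
∑<-≡-bound⇒≢0 (suc n) t t≤1 total zero    _         t0≡0 =
  1+n≰n (subst (_≤ n) (trans (cong (_+ ∑< n (t ∘ suc)) (sym t0≡0)) total) (∑<-≤ n (t ∘ suc) (t≤1 ∘ suc)))
∑<-≡-bound⇒≢0 (suc n) t t≤1 total (suc v) (s≤s v<n) =
  ∑<-≡-bound⇒≢0 n (t ∘ suc) (t≤1 ∘ suc) rest-total v v<n
  where
  rest-total : ∑< n (t ∘ suc) ≡ n
  rest-total = ≤-antisym (∑<-≤ n (t ∘ suc) (t≤1 ∘ suc))
    (≤-pred (subst (_≤ suc (∑< n (t ∘ suc))) total (+-monoˡ-≤ (∑< n (t ∘ suc)) (t≤1 0))))

𝟙 : {P : Set} → Dec P → ℕ
𝟙 d = if does d then 1 else 0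

𝟙-⇔ : {P Q : Set} → P ⇔ Q → (p? : Dec P) (q? : Dec Q) → 𝟙 p? ≡ 𝟙 q?
𝟙-⇔ P⇔Q p? q? = cong (λ b → if b then 1 else 0) (does-⇔ P⇔Q p? q?)

𝟙-no : {P : Set} → ¬ P → (p? : Dec P) → 𝟙 p? ≡ 0
𝟙-no ¬p p? = cong (λ b → if b then 1 else 0) (dec-false p? ¬p)

𝟙-×-dec : {P Q : Set} (p? : Dec P) (q? : Dec Q) → 𝟙 (p? ×-dec q?) ≡ 𝟙 p? * 𝟙 q?
𝟙-×-dec p? q? with does p? | does q?
... | true  | true  = refl
... | true  | false = refl
... | false | _     = refl

does-≡⇒ : {P Q : Set} (p? : Dec P) (q? : Dec Q) → does p? ≡ does q? → P → Q
does-≡⇒ (yes _)  (yes q) _  _ = q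
does-≡⇒ (yes _)  (no _)  () _
does-≡⇒ (no ¬p)  _       _  p = ⊥-elim (¬p p)

length-filter≡∑𝟙 : {P : X → Set} (P? : Decidable P) (xs : List X) → length (filter P? xs) ≡ ∑[ x ∈ xs ] 𝟙 (P? x)
length-filter≡∑𝟙 P? []       = refl
length-filter≡∑𝟙 P? (x ∷ xs) with does (P? x)
... | true  = cong suc (length-filter≡∑𝟙 P? xs)
... | false = length-filter≡∑𝟙 P? xs

length-filter-filter : {P Q : X → Set} (P? : Decidable P) (Q? : Decidable Q) (xs : List X) →
                       length (filter Q? (filter P? xs)) ≡ ∑[ x ∈ xs ] 𝟙 (P? x ×-dec Q? x)
length-filter-filter P? Q? []       = refl
length-filter-filter P? Q? (x ∷ xs) with does (P? x)
... | false = length-filter-filter P? Q? xs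
... | true with does (Q? x)
...   | true  = cong suc (length-filter-filter P? Q? xs)
...   | false = length-filter-filter P? Q? xs

∑<-𝟙≟ : ∀ b n → b < n → ∑[ w < n ] 𝟙 (w ≟ℕ b) ≡ 1
∑<-𝟙≟ zero    (suc n) _         = cong suc (∑<-zero n)
∑<-𝟙≟ (suc b) (suc n) (s≤s b<n) = ∑<-𝟙≟ b n b<n

module _ {Y : Set} (_≟_ : DecidableEquality Y) where

  open import Data.List.Membership.DecPropositional _≟_ using () renaming (_∈?_ to _∈?ʸ_)

  ∑𝟙≟-≤1 : (f : X → Y) {xs : List X} → Unique (map f xs) → ∀ y → ∑[ x ∈ xs ] 𝟙 (y ≟ f x) ≤ 1
  ∑𝟙≟-≤1 f {[]}     _              y = z≤n
  ∑𝟙≟-≤1 f {x ∷ xs} (fx∉ ∷ unique) y with y ≟ f x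
  ... | no _     = ∑𝟙≟-≤1 f unique y
  ... | yes refl = ≤-reflexive (cong suc (trans (∑-cong-∈ xs others-absent) (∑-zero xs)))
    where
    others-absent : ∀ z → z ∈ xs → 𝟙 (f x ≟ f z) ≡ 0
    others-absent z z∈ = 𝟙-no (All.lookup fx∉ (∈-map⁺ f z∈)) (f x ≟ f z)

  ∑𝟙≟≢0⇒∃ : (f : X → Y) (xs : List X) (y : Y) → ∑[ x ∈ xs ] 𝟙 (y ≟ f x) ≢ 0 → ∃ λ x → x ∈ xs × y ≡ f x
  ∑𝟙≟≢0⇒∃ f []       y ≢0 = ⊥-elim (≢0 refl)
  ∑𝟙≟≢0⇒∃ f (x ∷ xs) y ≢0 with y ≟ f x
  ... | yes y≡fx = x , here refl , y≡fx
  ... | no _     = let (z , z∈ , y≡fz) = ∑𝟙≟≢0⇒∃ f xs y ≢0 in z , there z∈ , y≡fz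

  𝟙-∈? : ∀ y {xs} → Unique xs → 𝟙 (y ∈?ʸ xs) ≡ ∑[ x ∈ xs ] 𝟙 (y ≟ x)
  𝟙-∈? y {[]}     _             = refl
  𝟙-∈? y {x ∷ xs} (x∉ ∷ unique) with y ≟ x
  ... | no _     = 𝟙-∈? y unique
  ... | yes refl = cong suc (sym (trans (∑-cong-∈ xs (λ z z∈ → 𝟙-no (All.lookup x∉ z∈) (y ≟ z))) (∑-zero xs)))

applyUpTo-cong : ∀ n {f g : ℕ → X} → (∀ v → v < n → f v ≡ g v) → applyUpTo f n ≡ applyUpTo g n
applyUpTo-cong zero    e = refl
applyUpTo-cong (suc n) e = cong₂ _∷_ (e 0 (s≤s z≤n)) (applyUpTo-cong n (λ v v<n → e (suc v) (s≤s v<n)))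

applyUpTo-≡⇒≡ : ∀ n {f g : ℕ → X} → applyUpTo f n ≡ applyUpTo g n → ∀ v → v < n → f v ≡ g v
applyUpTo-≡⇒≡ (suc n) e zero    _         = ∷-injectiveˡ e
applyUpTo-≡⇒≡ (suc n) e (suc v) (s≤s v<n) = applyUpTo-≡⇒≡ n (∷-injectiveʳ e) v v<n

length-++-∷-∷ : ∀ (α : List X) {x y β} → suc (suc (length α)) ≤ length (α ++ x ∷ y ∷ β)
length-++-∷-∷ []      = s≤s (s≤s z≤n)
length-++-∷-∷ (_ ∷ α) = s≤s (length-++-∷-∷ α)

∈-map-involution : (f : X → X) → (∀ x → f (f x) ≡ x) → ∀ {y xs} → y ∈ map f xs ⇔ f y ∈ xs
∈-map-involution f f-inv {y} = mk⇔
  (λ y∈ → let (x , x∈ , y≡fx) = ∈-map⁻ f y∈ in subst (_∈ _) (sym (trans (cong f y≡fx) (f-inv x))) x∈)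
  (λ fy∈ → subst (_∈ _) (f-inv y) (∈-map⁺ f fy∈))

Unique-map⇒≡ : (f : X → Y) {xs : List X} → Unique (map f xs) → ∀ {x y} → x ∈ xs → y ∈ xs → f x ≡ f y → x ≡ y
Unique-map⇒≡ f (_ ∷ _)      (here refl) (here refl) _ = refl
Unique-map⇒≡ f (fx≢ ∷ _)    (here refl) (there y∈)  e = ⊥-elim (All.lookup fx≢ (∈-map⁺ f y∈) e)
Unique-map⇒≡ f (fy≢ ∷ _)    (there x∈)  (here refl) e = ⊥-elim (All.lookup fy≢ (∈-map⁺ f x∈) (sym e))
Unique-map⇒≡ f (_ ∷ unique) (there x∈)  (there y∈)  e = Unique-map⇒≡ f unique x∈ y∈ e

tuples-length : ∀ m (xs : List X) → All (λ σ → length σ ≡ m) (tuples m xs)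
tuples-length zero    xs = refl ∷ []
tuples-length (suc m) xs =
  All.concat⁺ (All.map⁺ (All.universal (λ _ → All.map⁺ (All.map (cong suc) (tuples-length m xs))) xs))

∑-tuples-map : (f : X → X) (xs : List X) → (∀ h → ∑[ x ∈ xs ] h (f x) ≡ ∑ xs h) →
               ∀ m (g : List X → ℕ) → ∑[ σ ∈ tuples m xs ] g (map f σ) ≡ ∑ (tuples m xs) g
∑-tuples-map f xs f-permutes zero    g = refl
∑-tuples-map f xs f-permutes (suc m) g = begin
  ∑[ σ ∈ tuples (suc m) xs ] g (map f σ)
    ≡⟨ ∑-concatMap _ xs _ ⟩
  ∑[ x ∈ xs ] ∑[ σ ∈ map (x ∷_) (tuples m xs) ] g (map f σ)
    ≡⟨ ∑-cong xs (λ x → ∑-map (x ∷_) (tuples m xs) _) ⟩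
  ∑[ x ∈ xs ] ∑[ σ ∈ tuples m xs ] g (f x ∷ map f σ)
    ≡⟨ ∑-cong xs (λ x → ∑-tuples-map f xs f-permutes m (g ∘ (f x ∷_))) ⟩
  ∑[ x ∈ xs ] ∑[ σ ∈ tuples m xs ] g (f x ∷ σ)
    ≡⟨ f-permutes (λ y → ∑[ σ ∈ tuples m xs ] g (y ∷ σ)) ⟩
  ∑[ x ∈ xs ] ∑[ σ ∈ tuples m xs ] g (x ∷ σ)
    ≡⟨ ∑-cong xs (λ x → ∑-map (x ∷_) (tuples m xs) g) ⟨
  ∑[ x ∈ xs ] ∑ (map (x ∷_) (tuples m xs)) g
    ≡⟨ ∑-concatMap _ xs g ⟨
  ∑ (tuples (suc m) xs) g
    ∎
  where open ≡-Reasoning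

-- Adjacent transpositions

adjSwap : ℕ → ℕ → ℕ
adjSwap zero    zero          = 1
adjSwap zero    (suc zero)    = 0
adjSwap zero    (suc (suc a)) = suc (suc a)
adjSwap (suc p) zero          = zero
adjSwap (suc p) (suc a)       = suc (adjSwap p a)

adjSwap-involutive : ∀ p a → adjSwap p (adjSwap p a) ≡ a
adjSwap-involutive zero    zero          = refl
adjSwap-involutive zero    (suc zero)    = refl
adjSwap-involutive zero    (suc (suc a)) = refl
adjSwap-involutive (suc p) zero          = refl
adjSwap-involutive (suc p) (suc a)       = cong suc (adjSwap-involutive p a)

adjSwap-injective : ∀ p {a b} → adjSwap p a ≡ adjSwap p b → a ≡ b
adjSwap-injective p {a} {b} e =
  trans (sym (adjSwap-involutive p a)) (trans (cong (adjSwap p) e) (adjSwap-involutive p b))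

adjSwap-≤ : ∀ p a n → suc p ≤ n → a ≤ n → adjSwap p a ≤ n
adjSwap-≤ zero    zero          n       p<n       _         = p<n
adjSwap-≤ zero    (suc zero)    n       _         _         = z≤n
adjSwap-≤ zero    (suc (suc a)) n       _         a≤n       = a≤n
adjSwap-≤ (suc p) zero          n       _         _         = z≤n
adjSwap-≤ (suc p) (suc a)       (suc n) (s≤s p<n) (s≤s a≤n) = s≤s (adjSwap-≤ p a n p<n a≤n)

adjSwap-<ᵇ : ∀ p a b → ¬ (a ≡ p × b ≡ suc p) → ¬ (a ≡ suc p × b ≡ p) →
             (b <ᵇ a) ≡ (adjSwap p b <ᵇ adjSwap p a)
adjSwap-<ᵇ zero    zero          zero          _  _  = refl
adjSwap-<ᵇ zero    zero          (suc zero)    ne _  = ⊥-elim (ne (refl , refl))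
adjSwap-<ᵇ zero    zero          (suc (suc b)) _  _  = refl
adjSwap-<ᵇ zero    (suc zero)    zero          _  ne = ⊥-elim (ne (refl , refl))
adjSwap-<ᵇ zero    (suc zero)    (suc zero)    _  _  = refl
adjSwap-<ᵇ zero    (suc zero)    (suc (suc b)) _  _  = refl
adjSwap-<ᵇ zero    (suc (suc a)) zero          _  _  = refl
adjSwap-<ᵇ zero    (suc (suc a)) (suc zero)    _  _  = refl
adjSwap-<ᵇ zero    (suc (suc a)) (suc (suc b)) _  _  = refl
adjSwap-<ᵇ (suc p) zero          zero          _  _  = refl
adjSwap-<ᵇ (suc p) zero          (suc b)       _  _  = refl
adjSwap-<ᵇ (suc p) (suc a)       zero          _  _  = refl
adjSwap-<ᵇ (suc p) (suc a)       (suc b)       ne ne′ =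
  adjSwap-<ᵇ p a b (λ (e , e′) → ne (cong suc e , cong suc e′)) (λ (e , e′) → ne′ (cong suc e , cong suc e′))

∑<-adjSwap : ∀ p n (h : ℕ → ℕ) → suc p < n → ∑[ a < n ] h (adjSwap p a) ≡ ∑< n h
∑<-adjSwap zero    (suc (suc n)) h _ = x∙yz≈y∙xz (h 1) (h 0) _
∑<-adjSwap zero    (suc zero)    h (s≤s ())
∑<-adjSwap (suc p) (suc n)       h (s≤s p<n) = cong (h 0 +_) (∑<-adjSwap p n (h ∘ suc) p<n)

applyUpTo-≡-++ : ∀ (g : ℕ → X) n α {x y β} → applyUpTo g n ≡ α ++ x ∷ y ∷ β →
                 g (length α) ≡ x × g (suc (length α)) ≡ y
applyUpTo-≡-++ g (suc (suc n)) []      refl = refl , refl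
applyUpTo-≡-++ g (suc n)       (_ ∷ α) e    = applyUpTo-≡-++ (g ∘ suc) n α (∷-injectiveʳ e)

applyUpTo-adjSwap : ∀ (g : ℕ → X) n α {x y β} → applyUpTo g n ≡ α ++ x ∷ y ∷ β →
                    applyUpTo (g ∘ adjSwap (length α)) n ≡ α ++ y ∷ x ∷ β
applyUpTo-adjSwap g (suc (suc n)) []      refl = refl
applyUpTo-adjSwap g (suc n)       (_ ∷ α) e    =
  cong₂ _∷_ (∷-injectiveˡ e) (applyUpTo-adjSwap (g ∘ suc) n α (∷-injectiveʳ e))

-- Exchanges ±(s+1) with ±(s+2), keeping signs; note -[1+ b ] = -(b+1).
adjSwapℤ : ℕ → ℤ → ℤ
adjSwapℤ s (ℤ.+ a)  = ℤ.+ adjSwap (suc s) a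
adjSwapℤ s -[1+ b ] = -[1+ adjSwap s b ]

adjSwapℤ-involutive : ∀ s x → adjSwapℤ s (adjSwapℤ s x) ≡ x
adjSwapℤ-involutive s (ℤ.+ a)  = cong ℤ.+_ (adjSwap-involutive (suc s) a)
adjSwapℤ-involutive s -[1+ b ] = cong -[1+_] (adjSwap-involutive s b)

map-adjSwapℤ-involutive : ∀ s σ → map (adjSwapℤ s) (map (adjSwapℤ s) σ) ≡ σ
map-adjSwapℤ-involutive s σ = trans (sym (map-∘ σ)) (trans (map-cong (adjSwapℤ-involutive s) σ) (map-id σ))

∣adjSwapℤ∣ : ∀ s x → ∣ adjSwapℤ s x ∣ ≡ adjSwap (suc s) ∣ x ∣
∣adjSwapℤ∣ s (ℤ.+ a)  = refl
∣adjSwapℤ∣ s -[1+ b ] = refl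

data SwappedPair (s : ℕ) : ℤ → ℤ → Set where
  positive  : SwappedPair s (ℤ.+ suc s) (ℤ.+ suc (suc s))
  positive′ : SwappedPair s (ℤ.+ suc (suc s)) (ℤ.+ suc s)
  negative  : SwappedPair s -[1+ s ] -[1+ suc s ]
  negative′ : SwappedPair s -[1+ suc s ] -[1+ s ]

adjSwapℤ-<? : ∀ s x y → ¬ SwappedPair s x y → does (y <? x) ≡ does (adjSwapℤ s y <? adjSwapℤ s x)
adjSwapℤ-<? s (ℤ.+ a)  (ℤ.+ b)  ¬swapped = adjSwap-<ᵇ (suc s) a b
  (λ { (refl , refl) → ¬swapped positive }) (λ { (refl , refl) → ¬swapped positive′ })
adjSwapℤ-<? s (ℤ.+ a)  -[1+ b ] _        = refl
adjSwapℤ-<? s -[1+ a ] (ℤ.+ b)  _        = refl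
adjSwapℤ-<? s -[1+ a ] -[1+ b ] ¬swapped = adjSwap-<ᵇ s b a
  (λ { (refl , refl) → ¬swapped negative′ }) (λ { (refl , refl) → ¬swapped negative })

∑-range : ∀ n (h : ℤ → ℕ) → ∑ (range n) h ≡ (∑[ a < suc n ] h (ℤ.+ a)) + (∑[ b < n ] h -[1+ b ])
∑-range n h = trans (∑-++ (map ℤ.+_ (upTo (suc n))) _ h) (cong₂ _+_
  (trans (∑-map ℤ.+_ (upTo (suc n)) h) (∑-applyUpTo (suc n) (λ a → a) _))
  (trans (∑-map _ (upTo n) h) (∑-applyUpTo n (λ a → a) _)))

∑-range-adjSwapℤ : ∀ s n → suc (suc s) ≤ n → (h : ℤ → ℕ) → ∑[ x ∈ range n ] h (adjSwapℤ s x) ≡ ∑ (range n) h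
∑-range-adjSwapℤ s n s+2≤n h = begin
  ∑[ x ∈ range n ] h (adjSwapℤ s x)
    ≡⟨ ∑-range n (h ∘ adjSwapℤ s) ⟩
  (∑[ a < suc n ] h (ℤ.+ adjSwap (suc s) a)) + (∑[ b < n ] h -[1+ adjSwap s b ])
    ≡⟨ cong₂ _+_ (∑<-adjSwap (suc s) (suc n) (h ∘ ℤ.+_) (s≤s s+2≤n)) (∑<-adjSwap s n (h ∘ -[1+_]) s+2≤n) ⟩
  (∑[ a < suc n ] h (ℤ.+ a)) + (∑[ b < n ] h -[1+ b ])
    ≡⟨ ∑-range n h ⟨
  ∑ (range n) h
    ∎
  where open ≡-Reasoning

-- Boolean words

#true : List Bool → ℕ
#true ε = ∑[ b ∈ ε ] 𝟙 (T? b)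

#false : List Bool → ℕ
#false ε = ∑[ b ∈ ε ] 𝟙 (T? (not b))

#true+#false≡length : ∀ ε → #true ε + #false ε ≡ length ε
#true+#false≡length []          = refl
#true+#false≡length (true ∷ ε)  = cong suc (#true+#false≡length ε)
#true+#false≡length (false ∷ ε) = trans (+-suc (#true ε) (#false ε)) (cong suc (#true+#false≡length ε))

canonical : List Bool → List Bool
canonical ε = replicate (#true ε) true ++ replicate (#false ε) false

module _ {F : List Bool → X} (F-adjSwap : ∀ α x y β → F (α ++ x ∷ y ∷ β) ≡ F (α ++ y ∷ x ∷ β)) where

  private
    F-shift : ∀ α x β → F (α ++ x ∷ β) ≡ F ((α ++ [ x ]) ++ β)
    F-shift α x β = cong F (sym (++-assoc α [ x ] β))

    false-past-trues : ∀ m α γ → F (α ++ false ∷ replicate m true ++ γ) ≡ F (α ++ replicate m true ++ false ∷ γ)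
    false-past-trues zero    α γ = refl
    false-past-trues (suc m) α γ = begin
      F (α ++ false ∷ true ∷ replicate m true ++ γ)         ≡⟨ F-adjSwap α false true _ ⟩
      F (α ++ true ∷ false ∷ replicate m true ++ γ)         ≡⟨ F-shift α true _ ⟩
      F ((α ++ [ true ]) ++ false ∷ replicate m true ++ γ)  ≡⟨ false-past-trues m (α ++ [ true ]) γ ⟩
      F ((α ++ [ true ]) ++ replicate m true ++ false ∷ γ)  ≡⟨ F-shift α true _ ⟨
      F (α ++ true ∷ replicate m true ++ false ∷ γ)         ∎
      where open ≡-Reasoning

    canonical-suffix : ∀ ε α → F (α ++ ε) ≡ F (α ++ canonical ε)
    canonical-suffix []          α = refl
    canonical-suffix (true ∷ ε)  α = begin
      F (α ++ true ∷ ε)                     ≡⟨ F-shift α true ε ⟩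
      F ((α ++ [ true ]) ++ ε)              ≡⟨ canonical-suffix ε (α ++ [ true ]) ⟩
      F ((α ++ [ true ]) ++ canonical ε)    ≡⟨ F-shift α true _ ⟨
      F (α ++ true ∷ canonical ε)           ∎
      where open ≡-Reasoning
    canonical-suffix (false ∷ ε) α = begin
      F (α ++ false ∷ ε)                                                       ≡⟨ F-shift α false ε ⟩
      F ((α ++ [ false ]) ++ ε)                                                ≡⟨ canonical-suffix ε (α ++ [ false ]) ⟩
      F ((α ++ [ false ]) ++ canonical ε)                                      ≡⟨ F-shift α false _ ⟨
      F (α ++ false ∷ replicate (#true ε) true ++ replicate (#false ε) false)  ≡⟨ false-past-trues (#true ε) α _ ⟩
      F (α ++ canonical (false ∷ ε))                                           ∎
      where open ≡-Reasoning

  invariant-canonical : ∀ ε → F ε ≡ F (canonical ε)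
  invariant-canonical ε = canonical-suffix ε []

boolLists : ℕ → List (List Bool)
boolLists n = tuples n (true ∷ false ∷ [])

∑-boolLists-suc : ∀ n (g : List Bool → ℕ) →
                  ∑ (boolLists (suc n)) g ≡ (∑[ ε ∈ boolLists n ] g (true ∷ ε)) + (∑[ ε ∈ boolLists n ] g (false ∷ ε))
∑-boolLists-suc n g = trans (∑-concatMap (λ x → map (x ∷_) (boolLists n)) (true ∷ false ∷ []) g) (cong₂ _+_
  (∑-map (true ∷_) (boolLists n) g)
  (trans (+-identityʳ _) (∑-map (false ∷_) (boolLists n) g)))

∑-boolLists-#true : ∀ n j → ∑[ ε ∈ boolLists n ] 𝟙 (#true ε ≟ℕ j) ≡ n C j
∑-boolLists-#true zero    zero    = refl
∑-boolLists-#true zero    (suc j) = refl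
∑-boolLists-#true (suc n) zero    = trans (∑-boolLists-suc n _) (cong₂ _+_ (∑-zero (boolLists n)) (∑-boolLists-#true n zero))
∑-boolLists-#true (suc n) (suc j) = begin
  ∑[ ε ∈ boolLists (suc n) ] 𝟙 (#true ε ≟ℕ suc j)
    ≡⟨ ∑-boolLists-suc n _ ⟩
  (∑[ ε ∈ boolLists n ] 𝟙 (#true ε ≟ℕ j)) + (∑[ ε ∈ boolLists n ] 𝟙 (#true ε ≟ℕ suc j))
    ≡⟨ cong₂ _+_ (∑-boolLists-#true n j) (∑-boolLists-#true n (suc j)) ⟩
  n C j + n C suc j
    ≡⟨ nCk+nC[k+1]≡[n+1]C[k+1] n j ⟩
  suc n C suc j
    ∎
  where open ≡-Reasoning

∑-boolLists-select : ∀ n v (c : List Bool → ℕ) → length v ≡ n → ∑[ ε ∈ boolLists n ] c ε * 𝟙 (≡-dec _≟ᵇ_ v ε) ≡ c v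
∑-boolLists-select zero    []          c _ = trans (+-identityʳ _) (*-identityʳ (c []))
∑-boolLists-select (suc n) (true ∷ v)  c e = trans (∑-boolLists-suc n _) (trans
  (cong₂ _+_ (∑-boolLists-select n v (c ∘ (true ∷_)) (suc-injective e)) (∑-*0 (boolLists n) (c ∘ (false ∷_))))
  (+-identityʳ _))
∑-boolLists-select (suc n) (false ∷ v) c e = trans (∑-boolLists-suc n _)
  (cong₂ _+_ (∑-*0 (boolLists n) (c ∘ (true ∷_))) (∑-boolLists-select n v (c ∘ (false ∷_)) (suc-injective e)))

∑-boolLists-select-× : ∀ n v (c : List Bool → ℕ) {G : Set} (g? : Dec G) → length v ≡ n →
                       ∑[ ε ∈ boolLists n ] c ε * 𝟙 (g? ×-dec ≡-dec _≟ᵇ_ v ε) ≡ c v * 𝟙 g?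
∑-boolLists-select-× n v c (yes _) e = trans (∑-boolLists-select n v c e) (sym (*-identityʳ (c v)))
∑-boolLists-select-× n v c (no _)  e = trans (∑-*0 (boolLists n) c) (sym (*-zeroʳ (c v)))

-- Signed permutations

descentsFrom-map : (f : ℤ → ℤ) (xs : List ℤ) →
                   (∀ {x y} → x ∈ xs → y ∈ xs → does (y <? x) ≡ does (f y <? f x)) →
                   descentsFrom (map f xs) ≡ descentsFrom xs
descentsFrom-map f []           _        = refl
descentsFrom-map f (x ∷ [])     _        = refl
descentsFrom-map f (x ∷ y ∷ xs) f-order =
  cong₂ _+_ (cong (λ c → if c then 1 else 0) (sym (f-order (here refl) (there (here refl)))))
            (descentsFrom-map f (y ∷ xs) (λ x∈ y∈ → f-order (there x∈) (there y∈)))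

-- Entry v records whether the value v+1 is negated in σ.
negPattern : ℕ → List ℤ → List Bool
negPattern n σ = applyUpTo (λ v → does (-[1+ v ] ∈? σ)) n

negPattern-adjSwapℤ : ∀ s n σ → negPattern n (map (adjSwapℤ s) σ) ≡ applyUpTo (λ v → does (-[1+ adjSwap s v ] ∈? σ)) n
negPattern-adjSwapℤ s n σ =
  applyUpTo-cong n (λ v _ →
    does-⇔ (∈-map-involution (adjSwapℤ s) (adjSwapℤ-involutive s)) (-[1+ v ] ∈? map (adjSwapℤ s) σ) (_ ∈? σ))

adjSwapℤ-IsSignedPerm : ∀ s n σ → suc (suc s) ≤ n → IsSignedPerm n σ → IsSignedPerm n (map (adjSwapℤ s) σ)
adjSwapℤ-IsSignedPerm s n σ s+2≤n (length≡n , bounded , unique) =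
  trans (length-map (adjSwapℤ s) σ) length≡n ,
  All.map⁺ (All.map (λ {x} → subst (λ a → 1 ≤ a × a ≤ n) (sym (∣adjSwapℤ∣ s x)) ∘ adjSwap-bounded) bounded) ,
  subst Unique (map-∘∣∣ σ) (Unique.map⁺ (adjSwap-injective (suc s)) unique)
  where
  adjSwap-bounded : ∀ {a} → 1 ≤ a × a ≤ n → 1 ≤ adjSwap (suc s) a × adjSwap (suc s) a ≤ n
  adjSwap-bounded {suc a} (_ , a≤n) = s≤s z≤n , adjSwap-≤ (suc s) (suc a) n s+2≤n a≤n
  map-∘∣∣ : ∀ σ → map (adjSwap (suc s)) (map ∣_∣ σ) ≡ map ∣_∣ (map (adjSwapℤ s) σ)
  map-∘∣∣ σ = trans (sym (map-∘ σ)) (trans (map-cong (sym ∘ ∣adjSwapℤ∣ s) σ) (map-∘ σ))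

module _ {n : ℕ} {σ : List ℤ} (σ∈Bₙ : IsSignedPerm n σ) where

  +∈⇒-∉ : ∀ {m} → ℤ.+ suc m ∈ σ → ¬ -[1+ m ] ∈ σ
  +∈⇒-∉ +m∈ -m∈ with () ← Unique-map⇒≡ ∣_∣ (proj₂ (proj₂ σ∈Bₙ)) -m∈ +m∈ refl

  -- A SwappedPair in 0 ∷ σ would force s+1 and s+2 to be both negated or both not.
  des-adjSwapℤ : ∀ s → does (-[1+ s ] ∈? σ) ≢ does (-[1+ suc s ] ∈? σ) → des (map (adjSwapℤ s) σ) ≡ des σ
  des-adjSwapℤ s signs-differ =
    descentsFrom-map (adjSwapℤ s) (ℤ.+ 0 ∷ σ) (λ x∈ y∈ → adjSwapℤ-<? s _ _ (not-swapped x∈ y∈))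
    where
    both-positive : ℤ.+ suc s ∈ σ → ℤ.+ suc (suc s) ∈ σ → does (-[1+ s ] ∈? σ) ≡ does (-[1+ suc s ] ∈? σ)
    both-positive x∈ y∈ = trans (dec-false (_ ∈? σ) (+∈⇒-∉ x∈)) (sym (dec-false (_ ∈? σ) (+∈⇒-∉ y∈)))
    both-negative : -[1+ s ] ∈ σ → -[1+ suc s ] ∈ σ → does (-[1+ s ] ∈? σ) ≡ does (-[1+ suc s ] ∈? σ)
    both-negative x∈ y∈ = trans (dec-true (_ ∈? σ) x∈) (sym (dec-true (_ ∈? σ) y∈))
    not-swapped : ∀ {x y} → x ∈ ℤ.+ 0 ∷ σ → y ∈ ℤ.+ 0 ∷ σ → ¬ SwappedPair s x y
    not-swapped (here refl) _           ()
    not-swapped (there _)   (here refl) ()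
    not-swapped (there x∈)  (there y∈)  positive  = signs-differ (both-positive x∈ y∈)
    not-swapped (there x∈)  (there y∈)  positive′ = signs-differ (both-positive y∈ x∈)
    not-swapped (there x∈)  (there y∈)  negative  = signs-differ (both-negative x∈ y∈)
    not-swapped (there x∈)  (there y∈)  negative′ = signs-differ (both-negative y∈ x∈)

-- Pigeonhole: the multiplicities of 1..n among the ∣σᵢ∣ are at most 1 and add up to n.
IsSignedPerm⇒∃∣∣≡ : ∀ {n σ} → IsSignedPerm n σ → ∀ v → v < n → ∃ λ x → x ∈ σ × suc v ≡ ∣ x ∣
IsSignedPerm⇒∃∣∣≡ {n} {σ} (length≡n , bounded , unique) v v<n =
  ∑𝟙≟≢0⇒∃ _≟ℕ_ ∣_∣ σ (suc v) (∑<-≡-bound⇒≢0 n multiplicity (λ w → ∑𝟙≟-≤1 _≟ℕ_ ∣_∣ unique (suc w)) total v v<n)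
  where
  multiplicity : ℕ → ℕ
  multiplicity w = ∑[ x ∈ σ ] 𝟙 (suc w ≟ℕ ∣ x ∣)
  hit-once : ∀ c → 1 ≤ c × c ≤ n → ∑[ w < n ] 𝟙 (suc w ≟ℕ c) ≡ 1
  hit-once (suc c) (_ , c<n) = ∑<-𝟙≟ c n c<n
  total : ∑< n multiplicity ≡ n
  total = begin
    ∑[ w < n ] ∑[ x ∈ σ ] 𝟙 (suc w ≟ℕ ∣ x ∣)  ≡⟨ ∑<-∑-comm n _ σ ⟩
    ∑[ x ∈ σ ] ∑[ w < n ] 𝟙 (suc w ≟ℕ ∣ x ∣)  ≡⟨ ∑-cong-∈ σ (λ x x∈ → hit-once ∣ x ∣ (All.lookup bounded x∈)) ⟩
    ∑[ x ∈ σ ] 1                                ≡⟨ ∑-one σ ⟩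
    length σ                                    ≡⟨ length≡n ⟩
    n                                           ∎
    where open ≡-Reasoning

∑<-𝟙-negsuc≟ : ∀ n x → ∣ x ∣ ≤ n → ∑[ v < n ] 𝟙 (-[1+ v ] ≟ℤ x) ≡ 𝟙 (x <? ℤ.+ 0)
∑<-𝟙-negsuc≟ n (ℤ.+ a)  _   = ∑<-zero n
∑<-𝟙-negsuc≟ n -[1+ b ] b<n = ∑<-𝟙≟ b n b<n

#true-negPattern : ∀ {n σ} → IsSignedPerm n σ → #true (negPattern n σ) ≡ neg σ
#true-negPattern {n} {σ} (_ , bounded , unique) = begin
  #true (negPattern n σ)                       ≡⟨ ∑-applyUpTo n _ _ ⟩
  ∑[ v < n ] 𝟙 (-[1+ v ] ∈? σ)                 ≡⟨ ∑<-cong n (λ v → 𝟙-∈? _≟ℤ_ -[1+ v ] (Unique.map⁻ unique)) ⟩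
  ∑[ v < n ] ∑[ x ∈ σ ] 𝟙 (-[1+ v ] ≟ℤ x)     ≡⟨ ∑<-∑-comm n _ σ ⟩
  ∑[ x ∈ σ ] ∑[ v < n ] 𝟙 (-[1+ v ] ≟ℤ x)     ≡⟨ ∑-cong-∈ σ (λ x x∈ → ∑<-𝟙-negsuc≟ n x (proj₂ (All.lookup bounded x∈))) ⟩
  ∑[ x ∈ σ ] 𝟙 (x <? ℤ.+ 0)                    ≡⟨ length-filter≡∑𝟙 _ σ ⟨
  neg σ                                         ∎
  where open ≡-Reasoning

NegatedBelow : ℕ → ℕ → List ℤ → Set
NegatedBelow n j σ = ∀ v → v < n → (-[1+ v ] ∈ σ ⇔ v < j)

negPattern≡⇔NegatedBelow : ∀ n j σ → negPattern n σ ≡ applyUpTo (_<ᵇ j) n ⇔ NegatedBelow n j σ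
negPattern≡⇔NegatedBelow n j σ = mk⇔
  (λ pattern≡ v v<n → let entry = applyUpTo-≡⇒≡ n pattern≡ v v<n in
    mk⇔ (does-≡⇒ (_ ∈? σ) (v <ℕ? j) entry) (does-≡⇒ (v <ℕ? j) (_ ∈? σ) (sym entry)))
  (λ negated⇔< → applyUpTo-cong n (λ v v<n → does-⇔ (negated⇔< v v<n) (_ ∈? σ) (v <ℕ? j)))

NegExactlyBelow⇔NegatedBelow : ∀ {n j σ} → IsSignedPerm n σ → j ≤ n → NegExactlyBelow j σ ⇔ NegatedBelow n j σ
NegExactlyBelow⇔NegatedBelow {n} {j} {σ} σ∈Bₙ@(_ , bounded , _) j≤n = mk⇔ negatedBelow exactlyBelow
  where
  negatedBelow : NegExactlyBelow j σ → NegatedBelow n j σ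
  negatedBelow below v v<n = mk⇔ (λ -v∈ → proj₂ (proj₁ (All.lookup below -v∈) -<+)) <⇒negated
    where
    <⇒negated : v < j → -[1+ v ] ∈ σ
    <⇒negated v<j with IsSignedPerm⇒∃∣∣≡ σ∈Bₙ v v<n
    ... | -[1+ _ ] , x∈ , refl = x∈
    ... | ℤ.+ _    , x∈ , refl with +<+ () ← proj₂ (All.lookup below x∈) (s≤s z≤n , v<j)
  exactlyBelow : NegatedBelow n j σ → NegExactlyBelow j σ
  exactlyBelow negated⇔< = All.tabulate (λ {x} → sign-condition x)
    where
    sign-condition : ∀ x → x ∈ σ → (x <ℤ ℤ.+ 0 → 1 ≤ ∣ x ∣ × ∣ x ∣ ≤ j) × (1 ≤ ∣ x ∣ × ∣ x ∣ ≤ j → x <ℤ ℤ.+ 0)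
    sign-condition -[1+ v ]      x∈ =
      (λ _ → s≤s z≤n , Equivalence.to (negated⇔< v (proj₂ (All.lookup bounded x∈))) x∈) , (λ _ → -<+)
    sign-condition (ℤ.+ zero)    x∈ = (λ { (+<+ ()) }) , (λ { (() , _) })
    sign-condition (ℤ.+ suc v)   x∈ = (λ { (+<+ ()) }) , λ (_ , v<j) →
      ⊥-elim (+∈⇒-∉ σ∈Bₙ x∈ (Equivalence.from (negated⇔< v (<-≤-trans v<j j≤n)) v<j))

applyUpTo-<ᵇ : ∀ j n → j ≤ n → applyUpTo (_<ᵇ j) n ≡ replicate j true ++ replicate (n ∸ j) false
applyUpTo-<ᵇ zero    zero    _         = refl
applyUpTo-<ᵇ zero    (suc n) _         = cong (false ∷_) (applyUpTo-<ᵇ zero n z≤n)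
applyUpTo-<ᵇ (suc j) (suc n) (s≤s j≤n) = cong (true ∷_) (applyUpTo-<ᵇ j n j≤n)

-- Counting signed permutations of a given shape

HasShape : ℕ → ℕ → List Bool → List ℤ → Set
HasShape n k ε σ = (IsSignedPerm n σ × des σ ≡ k) × negPattern n σ ≡ ε

hasShape? : ∀ n k ε σ → Dec (HasShape n k ε σ)
hasShape? n k ε σ = (isSignedPerm? n σ ×-dec des σ ≟ℕ k) ×-dec ≡-dec _≟ᵇ_ (negPattern n σ) ε

HasShape⇒length : ∀ {n k ε σ} → HasShape n k ε σ → length ε ≡ n
HasShape⇒length {n} (_ , pattern≡) = trans (sym (cong length pattern≡)) (length-applyUpTo _ n)

HasShape-adjSwap : ∀ {n k} α {x y β σ} → x ≢ y → HasShape n k (α ++ x ∷ y ∷ β) σ →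
                   HasShape n k (α ++ y ∷ x ∷ β) (map (adjSwapℤ (length α)) σ)
HasShape-adjSwap {n} α {x} {y} {σ = σ} x≢y shape@((σ∈Bₙ , refl) , pattern≡) =
  (adjSwapℤ-IsSignedPerm (length α) n σ s+2≤n σ∈Bₙ ,
   des-adjSwapℤ σ∈Bₙ (length α) (λ e → x≢y (trans (sym x-entry) (trans e y-entry)))) ,
  trans (negPattern-adjSwapℤ (length α) n σ) (applyUpTo-adjSwap _ n α pattern≡)
  where
  s+2≤n : suc (suc (length α)) ≤ n
  s+2≤n = subst (_ ≤_) (HasShape⇒length shape) (length-++-∷-∷ α)
  x-entry : does (-[1+ length α ] ∈? σ) ≡ x
  x-entry = proj₁ (applyUpTo-≡-++ _ n α pattern≡)
  y-entry : does (-[1+ suc (length α) ] ∈? σ) ≡ y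
  y-entry = proj₂ (applyUpTo-≡-++ _ n α pattern≡)

shapeCount : ℕ → ℕ → List Bool → ℕ
shapeCount n k ε = ∑[ σ ∈ tuples n (range n) ] 𝟙 (hasShape? n k ε σ)

shapeCount-length : ∀ n k ε → length ε ≢ n → shapeCount n k ε ≡ 0
shapeCount-length n k ε length≢n = trans
  (∑-cong (tuples n (range n)) (λ σ → 𝟙-no (length≢n ∘ HasShape⇒length) (hasShape? n k ε σ)))
  (∑-zero (tuples n (range n)))

shapeCount-adjSwap≢ : ∀ n k α {x y β} → suc (suc (length α)) ≤ n → x ≢ y →
                      shapeCount n k (α ++ x ∷ y ∷ β) ≡ shapeCount n k (α ++ y ∷ x ∷ β)
shapeCount-adjSwap≢ n k α {x} {y} {β} s+2≤n x≢y = begin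
  ∑[ σ ∈ Tₙ ] 𝟙 (hasShape? n k ε σ)
    ≡⟨ ∑-tuples-map (adjSwapℤ s) (range n) (∑-range-adjSwapℤ s n s+2≤n) n _ ⟨
  ∑[ σ ∈ Tₙ ] 𝟙 (hasShape? n k ε (map (adjSwapℤ s) σ))
    ≡⟨ ∑-cong Tₙ (λ σ → 𝟙-⇔ (swap-shape σ) (hasShape? n k ε _) (hasShape? n k ε′ σ)) ⟩
  ∑[ σ ∈ Tₙ ] 𝟙 (hasShape? n k ε′ σ)
    ∎
  where
  open ≡-Reasoning
  s : ℕ
  s = length α
  Tₙ : List (List ℤ)
  Tₙ = tuples n (range n)
  ε ε′ : List Bool
  ε  = α ++ x ∷ y ∷ β
  ε′ = α ++ y ∷ x ∷ β
  swap-shape : ∀ σ → HasShape n k ε (map (adjSwapℤ s) σ) ⇔ HasShape n k ε′ σ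
  swap-shape σ = mk⇔
    (subst (HasShape n k ε′) (map-adjSwapℤ-involutive s σ) ∘ HasShape-adjSwap α x≢y)
    (HasShape-adjSwap α (x≢y ∘ sym))

shapeCount-adjSwap : ∀ n k α x y β → shapeCount n k (α ++ x ∷ y ∷ β) ≡ shapeCount n k (α ++ y ∷ x ∷ β)
shapeCount-adjSwap n k α x y β with x ≟ᵇ y | suc (suc (length α)) ≤? n
... | yes refl | _         = refl
... | no x≢y   | yes s+2≤n = shapeCount-adjSwap≢ n k α s+2≤n x≢y
... | no _     | no s+2≰n  =
  trans (shapeCount-length n k _ (too-short x y)) (sym (shapeCount-length n k _ (too-short y x)))
  where
  too-short : ∀ a b → length (α ++ a ∷ b ∷ β) ≢ n
  too-short a b e = s+2≰n (subst (_ ≤_) e (length-++-∷-∷ α))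

shapeCount-canonical : ∀ n k ε → shapeCount n k ε ≡ shapeCount n k (canonical ε)
shapeCount-canonical n k = invariant-canonical (shapeCount-adjSwap n k)

shapeCount-blocks≡b : ∀ n k j → j ≤ n → shapeCount n k (replicate j true ++ replicate (n ∸ j) false) ≡ b n k j
shapeCount-blocks≡b n k j j≤n = begin
  ∑[ σ ∈ Tₙ ] 𝟙 (hasShape? n k blocks σ)
    ≡⟨ ∑-cong Tₙ (λ σ → 𝟙-⇔ (same-condition σ) (hasShape? n k blocks σ) (signedPerm-des-below? σ)) ⟩
  ∑[ σ ∈ Tₙ ] 𝟙 (signedPerm-des-below? σ)
    ≡⟨ length-filter-filter (isSignedPerm? n) (λ σ → (des σ ≟ℕ k) ×-dec negExactlyBelow? j σ) Tₙ ⟨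
  b n k j
    ∎
  where
  open ≡-Reasoning
  Tₙ : List (List ℤ)
  Tₙ = tuples n (range n)
  blocks : List Bool
  blocks = replicate j true ++ replicate (n ∸ j) false
  blocks≡ : applyUpTo (_<ᵇ j) n ≡ blocks
  blocks≡ = applyUpTo-<ᵇ j n j≤n
  signedPerm-des-below? : ∀ σ → Dec (IsSignedPerm n σ × des σ ≡ k × NegExactlyBelow j σ)
  signedPerm-des-below? σ = isSignedPerm? n σ ×-dec (des σ ≟ℕ k) ×-dec negExactlyBelow? j σ
  same-condition : ∀ σ → HasShape n k blocks σ ⇔ (IsSignedPerm n σ × des σ ≡ k × NegExactlyBelow j σ)
  same-condition σ = mk⇔
    (λ ((σ∈Bₙ , des≡k) , pattern≡) → σ∈Bₙ , des≡k ,
      Equivalence.from (NegExactlyBelow⇔NegatedBelow σ∈Bₙ j≤n)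
        (Equivalence.to (negPattern≡⇔NegatedBelow n j σ) (trans pattern≡ (sym blocks≡))))
    (λ (σ∈Bₙ , des≡k , below) → (σ∈Bₙ , des≡k) , trans
      (Equivalence.from (negPattern≡⇔NegatedBelow n j σ) (Equivalence.to (NegExactlyBelow⇔NegatedBelow σ∈Bₙ j≤n) below))
      blocks≡)

shapeCount≡b : ∀ n k j ε → length ε ≡ n → #true ε ≡ j → shapeCount n k ε ≡ b n k j
shapeCount≡b n k j ε length≡n #true≡j = begin
  shapeCount n k ε                                                ≡⟨ shapeCount-canonical n k ε ⟩
  shapeCount n k (canonical ε)                                    ≡⟨ cong (shapeCount n k) canonical≡ ⟩
  shapeCount n k (replicate j true ++ replicate (n ∸ j) false)    ≡⟨ shapeCount-blocks≡b n k j j≤n ⟩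
  b n k j                                                         ∎
  where
  open ≡-Reasoning
  length≡ : #true ε + #false ε ≡ n
  length≡ = trans (#true+#false≡length ε) length≡n
  j≤n : j ≤ n
  j≤n = subst (_≤ n) #true≡j (subst (#true ε ≤_) length≡ (m≤m+n (#true ε) (#false ε)))
  canonical≡ : canonical ε ≡ replicate j true ++ replicate (n ∸ j) false
  canonical≡ = cong₂ (λ t f → replicate t true ++ replicate f false) #true≡j
    (trans (sym (m+n∸m≡n (#true ε) (#false ε))) (cong₂ _∸_ length≡ #true≡j))

weightedShapeCount : ℕ → ℕ → ℕ → ℕ
weightedShapeCount n k j = ∑[ ε ∈ boolLists n ] 𝟙 (#true ε ≟ℕ j) * shapeCount n k ε

weightedShapeCount≡C*b : ∀ n k j → weightedShapeCount n k j ≡ (n C j) * b n k j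
weightedShapeCount≡C*b n k j = begin
  ∑[ ε ∈ boolLists n ] 𝟙 (#true ε ≟ℕ j) * shapeCount n k ε
    ≡⟨ ∑-cong-∈ (boolLists n) (λ ε ε∈ → weight-b ε (#true ε ≟ℕ j) (All.lookup (tuples-length n _) ε∈)) ⟩
  ∑[ ε ∈ boolLists n ] 𝟙 (#true ε ≟ℕ j) * b n k j
    ≡⟨ ∑-*ʳ (boolLists n) _ (b n k j) ⟩
  (∑[ ε ∈ boolLists n ] 𝟙 (#true ε ≟ℕ j)) * b n k j
    ≡⟨ cong (_* b n k j) (∑-boolLists-#true n j) ⟩
  (n C j) * b n k j
    ∎
  where
  open ≡-Reasoning
  weight-b : ∀ ε (#true≟j : Dec (#true ε ≡ j)) → length ε ≡ n → 𝟙 #true≟j * shapeCount n k ε ≡ 𝟙 #true≟j * b n k j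
  weight-b ε (yes #true≡j) length≡n = cong (1 *_) (shapeCount≡b n k j ε length≡n #true≡j)
  weight-b ε (no _)        _        = refl

weightedShapeCount≡B : ∀ n k j → weightedShapeCount n k j ≡ B n k j
weightedShapeCount≡B n k j = begin
  ∑[ ε ∈ boolLists n ] c ε * shapeCount n k ε
    ≡⟨ ∑-cong (boolLists n) (λ ε → ∑-*ˡ Tₙ (c ε) _) ⟨
  ∑[ ε ∈ boolLists n ] ∑[ σ ∈ Tₙ ] c ε * 𝟙 (hasShape? n k ε σ)
    ≡⟨ ∑-comm (boolLists n) Tₙ _ ⟩
  ∑[ σ ∈ Tₙ ] ∑[ ε ∈ boolLists n ] c ε * 𝟙 (hasShape? n k ε σ)
    ≡⟨ ∑-cong Tₙ (λ σ → ∑-boolLists-select-× n (negPattern n σ) c (isSignedPerm? n σ ×-dec des σ ≟ℕ k) (length-applyUpTo _ n)) ⟩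
  ∑[ σ ∈ Tₙ ] c (negPattern n σ) * 𝟙 (isSignedPerm? n σ ×-dec des σ ≟ℕ k)
    ≡⟨ ∑-cong Tₙ (λ σ → weight-neg σ (isSignedPerm? n σ)) ⟩
  ∑[ σ ∈ Tₙ ] 𝟙 (isSignedPerm? n σ ×-dec (des σ ≟ℕ k ×-dec neg σ ≟ℕ j))
    ≡⟨ length-filter-filter (isSignedPerm? n) _ Tₙ ⟨
  B n k j
    ∎
  where
  open ≡-Reasoning
  Tₙ : List (List ℤ)
  Tₙ = tuples n (range n)
  c : List Bool → ℕ
  c ε = 𝟙 (#true ε ≟ℕ j)
  weight-neg : ∀ σ (σ∈Bₙ? : Dec (IsSignedPerm n σ)) →
               c (negPattern n σ) * 𝟙 (σ∈Bₙ? ×-dec des σ ≟ℕ k) ≡ 𝟙 (σ∈Bₙ? ×-dec (des σ ≟ℕ k ×-dec neg σ ≟ℕ j))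
  weight-neg σ (no _)     = *-zeroʳ (c (negPattern n σ))
  weight-neg σ (yes σ∈Bₙ) = begin
    𝟙 (#true (negPattern n σ) ≟ℕ j) * 𝟙 (des σ ≟ℕ k)  ≡⟨ cong (λ m → 𝟙 (m ≟ℕ j) * 𝟙 (des σ ≟ℕ k)) (#true-negPattern σ∈Bₙ) ⟩
    𝟙 (neg σ ≟ℕ j) * 𝟙 (des σ ≟ℕ k)                   ≡⟨ *-comm (𝟙 (neg σ ≟ℕ j)) _ ⟩
    𝟙 (des σ ≟ℕ k) * 𝟙 (neg σ ≟ℕ j)                   ≡⟨ 𝟙-×-dec (des σ ≟ℕ k) (neg σ ≟ℕ j) ⟨
    𝟙 (des σ ≟ℕ k ×-dec neg σ ≟ℕ j)                   ∎

-- Both bounds are superfluous: the identity holds for all n, k and j.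
corollary4p1 : (n k j : ℕ) → j ≤ n → k ≤ n →
    ((n C j) * b n k j ≡ B n k j) × ((n C j) ∣ B n k j)
corollary4p1 n k j _ _ = C*b≡B , divides (b n k j) (trans (sym C*b≡B) (*-comm (n C j) (b n k j)))
  where
  C*b≡B : (n C j) * b n k j ≡ B n k j
  C*b≡B = trans (sym (weightedShapeCount≡C*b n k j)) (weightedShapeCount≡B n k j)
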